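{- Let $\mathcal{A}=\{a_1\bmod d_1,\dots,a_n\bmod d_n\}$ be a finite set of congruences with $1<d_1\le d_2\le\cdots\le d_n$, and let $Q,p_j,\nu_j,Q_j,\alpha_j$ be as described in the context. Then for every $x\in\mathbb{Z}/Q\mathbb{Z}$ and every $j\in\{1,\dots,J\}$, \[ \alpha_j(x)\le \sum_{r=1}^{\nu_j}\ \sum_{g\mid Q_{j-1}}\ \sum_{\substack{1\le i\le n\\ d_i=g p_j^r}} \frac{\mathbf{1}_{x\subseteq a_i+g\mathbb{Z}}}{p_j^r}. \]
   Context: Let $Q=\operatorname{lcm}[d_1,\dots,d_n]$ and let $p_1<\cdots<p_J$ be the distinct primes dividing $Q$, with $Q=\prod_{i=1}^J p_i^{\nu_i}$ ($\nu_i$ the $p_i$-adic valuation of $Q$). Put $Q_0=1$ and $Q_j=\prod_{i=1}^j p_i^{\nu_i}$ for $1\le j\le J$. For $m\in\mathbb{N}$, $P^+(m)$ is the largest prime factor of $m$ (with $P^+(1)=1$). Define $\mathcal{B}_j=\bigcup_{1\le i\le n,\ P^+(d_i)=p_j}\{a\bmod Q: a\equiv a_i \bmod d_i\}\subseteq \mathbb{Z}/Q\mathbb{Z}$. Let $\pi_j:\mathbb{Z}/Q\mathbb{Z}\to\mathbb{Z}/Q_j\mathbb{Z}$ be the natural projection and $F_j(x)=\{x'\in\mathbb{Z}/Q\mathbb{Z}:\pi_j(x')=\pi_j(x)\}$. Define $\alpha_j(x)=|F_{j-1}(x)\cap\mathcal{B}_j|/|F_{j-1}(x)|$. A residue class $x\in\mathbb{Z}/Q\mathbb{Z}$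 is regarded as a subset of $\mathbb{Z}$, so $x\subseteq a_i+g\mathbb{Z}$ means every integer in the class $x$ is $\equiv a_i \bmod g$. -}

module Defs where

open import Data.Nat as ℕ using (ℕ; zero; suc; _≤_; _<_)
open import Data.Nat.LCM using (lcm)
open import Data.Nat.Primality using (Prime; prime?)
import Data.Nat.Divisibility as ℕD
open import Data.Integer as ℤ using (ℤ; +_; _-_; _+_)
open import Data.Integer.Divisibility.Signed using (_∣_; _∣?_; ∣-trans; ∣m∣n⇒∣m+n; ∣m∣n⇒∣m-n)
import Data.Integer.Properties as ℤP
open import Data.Integer.Solver using (module +-*-Solver)
open import Data.Fin as Fin using (Fin; toℕ)
open import Data.Fin.Properties using (any?)
open import Data.Bool using (Bool; true; false; if_then_else_; _∧_)
open import Data.List as List using (List; []; _∷_; filter; length; upTo; allFin)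
open import Data.Product using (∃; _×_; _,_)
open import Data.Rational as ℚ using (ℚ; 0ℚ)
open import Relation.Nullary using (Dec; yes; no; ¬_; does)
open import Relation.Nullary.Decidable using (_×-dec_)
open import Relation.Binary.PropositionalEquality using (_≡_; refl; subst; sym)
open import Function using (_∘_)

lcmAll : (n : ℕ) → (Fin n → ℕ) → ℕ
lcmAll zero    d = 1
lcmAll (suc n) d = lcm (d Fin.zero) (lcmAll n (d ∘ Fin.suc))

-- Q_k = ∏_{i < k} p_i ^ ν_i   (primes indexed from 0 in Agda: p (Fin i)
-- is the paper's p_{i+1}); Q_0 = 1 and Q_J = ∏_{all i} p_i^ν_i.

prodList : List ℕ → ℕ
prodList = List.foldr ℕ._*_ 1

Qpre : (J : ℕ) → (Fin J → ℕ) → (Fin J → ℕ) → ℕ → ℕ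
Qpre J p ν k =
  prodList (List.map (λ i → if does (toℕ i ℕ.<? k) then p i ℕ.^ ν i else 1) (allFin J))

-- P⁺(m): the largest prime factor of m, with P⁺(1) = 1.
-- lpfAux m k = largest prime q ≤ k with q ∣ m, or 1 if there is none.

lpfAux : ℕ → ℕ → ℕ
lpfAux m zero    = 1
lpfAux m (suc k) =
  if does (prime? (suc k)) ∧ does (suc k ℕD.∣? m) then suc k else lpfAux m k

P⁺ : ℕ → ℕ
P⁺ m = lpfAux m m

-- Elements of ℤ/Qℤ are represented by Fin Q (canonical representatives
-- 0..Q-1); the class of x is { z ∈ ℤ : Q ∣ z - x }.

ClassSubset : (Q : ℕ) → Fin Q → ℤ → ℕ → Set
ClassSubset Q x a g = ∀ (z : ℤ) → (+ Q) ∣ (z - + toℕ x) → (+ g) ∣ (z - a)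

private
  open +-*-Solver

  id1 : ∀ z x a → z - a ≡ (z - x) + (x - a)
  id1 = solve 3 (λ z x a → z :- a := (z :- x) :+ (x :- a)) refl

  id2 : ∀ x q a → q ≡ ((x + q) - a) - (x - a)
  id2 = solve 3 (λ x q a → q := ((x :+ q) :- a) :- (x :- a)) refl

  id3 : ∀ x → ℤ.0ℤ ≡ x - x
  id3 = solve 1 (λ x → con ℤ.0ℤ := x :- x) refl

  id4 : ∀ x q → q ≡ (x + q) - x
  id4 = solve 2 (λ x q → q := (x :+ q) :- x) refl

classSubset? : (Q : ℕ) (x : Fin Q) (a : ℤ) (g : ℕ) → Dec (ClassSubset Q x a g)
classSubset? Q x a g with (+ g) ∣? (+ toℕ x - a) | (+ g) ∣? (+ Q)
... | no ¬h | _ = no λ s → ¬h (s (+ toℕ x) (subst ((+ Q) ∣_) (id3 (+ toℕ x)) (record { quotient = ℤ.0ℤ ; equality = refl })))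
... | yes h | yes gQ = yes λ z Qz →
      subst ((+ g) ∣_) (sym (id1 z (+ toℕ x) a)) (∣m∣n⇒∣m+n (∣-trans gQ Qz) h)
... | yes h | no ¬gQ = no λ s →
      ¬gQ (subst ((+ g) ∣_) (sym (id2 (+ toℕ x) (+ Q) a))
        (∣m∣n⇒∣m-n (s (+ toℕ x + + Q) (subst ((+ Q) ∣_) (id4 (+ toℕ x) (+ Q)) (record { quotient = ℤ.1ℤ ; equality = sym (ℤP.*-identityˡ (+ Q)) }))) h))

count : (Q : ℕ) (P : Fin Q → Set) → (∀ y → Dec (P y)) → ℕ
count Q P P? = length (filter P? (allFin Q))

-- a / b as a rational number (with the convention a / 0 = 0; denominators
-- used below are never 0).
frac : ℕ → ℕ → ℚ
frac a zero    = 0ℚ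
frac a (suc b) = (+ a) ℚ./ suc b

sumℚ : List ℚ → ℚ
sumℚ = List.foldr ℚ._+_ 0ℚ

-- The data of the lemma.  j : Fin J is the paper's index j+1 ... we write
-- everything in terms of k = toℕ j, so the paper's Q_{j-1} is Qpre (toℕ j).

module _ (n : ℕ) (a : Fin n → ℤ) (d : Fin n → ℕ)
         (J : ℕ) (p : Fin J → ℕ) (ν : Fin J → ℕ) where

  private
    Q = lcmAll n d

  InF : Fin J → Fin Q → Fin Q → Set
  InF j x y = (+ Qpre J p ν (toℕ j)) ∣ (+ toℕ y - + toℕ x)

  inF? : (j : Fin J) (x y : Fin Q) → Dec (InF j x y)
  inF? j x y = _ ∣? _

  InB : Fin J → Fin Q → Set
  InB j y = ∃ λ (i : Fin n) → (P⁺ (d i) ≡ p j) × ((+ d i) ∣ (+ toℕ y - a i))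

  inB? : (j : Fin J) (y : Fin Q) → Dec (InB j y)
  inB? j y = any? (λ i → (P⁺ (d i) ℕ.≟ p j) ×-dec ((+ d i) ∣? (+ toℕ y - a i)))

  α : Fin J → Fin Q → ℚ
  α j x = frac (count Q (λ y → InF j x y × InB j y) (λ y → inF? j x y ×-dec inB? j y))
               (count Q (InF j x) (inF? j x))

  bound : Fin J → Fin Q → ℚ
  bound j x =
    sumℚ (List.map (λ r →
      sumℚ (List.map (λ g →
        sumℚ (List.map (λ i →
               if does (classSubset? Q x (a i) g) then frac 1 (p j ℕ.^ r) else 0ℚ)
          (filter (λ i → d i ℕ.≟ g ℕ.* p j ℕ.^ r) (allFin n))))
        (filter (λ g → g ℕD.∣? Qpre J p ν (toℕ j)) (List.map suc (upTo (Qpre J p ν (toℕ j)))))))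
      (List.map suc (upTo (ν j))))

-- Write Q = M · p^ν · R with M = Q_{j-1}, p = p_j, ν = ν_j, and R the product of the prime
-- powers above p.  Then F_{j-1}(x) is the set of v < Q with v ≡ x (mod M), and it meets every
-- block of M consecutive integers, so N = |F_{j-1}(x)| ≥ Q/M.  If P⁺(d_i) = p then
-- d_i = g p^r with 1 ≤ r ≤ ν and g ∣ M.  Since M and p^r are coprime, a block of M p^r
-- consecutive integers contains at most one v with v ≡ x (mod M) and v ≡ a_i (mod d_i), so
-- there are at most Q/(M p^r) ≤ N/p^r such v; and if there is one, then g divides M and d_i,
-- whence x ⊆ a_i + gℤ.  A union bound over the i with P⁺(d_i) = p gives the inequality.

module Submission where

open import Defs
open import Level using (0ℓ)
open import Algebra.Bundles using (CommutativeMonoid)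
import Algebra.Properties.CommutativeSemigroup as CommSemigroupProperties
open import Data.Bool using (true; false; if_then_else_; _∧_)
open import Data.Empty using (⊥-elim)
open import Data.Fin as Fin using (Fin; toℕ)
import Data.Fin.Properties as Finₚ
open import Data.Fin.Properties using (any?)
open import Data.Integer as ℤ using (ℤ; +_)
import Data.Integer.Properties as ℤₚ
import Data.Integer.Divisibility.Signed as ℤ∣
import Data.Integer.Tactic.RingSolver as ℤTactic
open import Data.List as List using (List; []; _∷_; filter; length; allFin; upTo)
import Data.List.Properties as Listₚ
open import Data.List.Membership.Propositional using (_∈_)
open import Data.List.Membership.Propositional.Properties using (∈-map⁺; ∈-filter⁺; ∈-allFin; ∈-upTo⁺)
open import Data.List.Relation.Unary.All using (_∷_)
open import Data.List.Relation.Unary.Any using (here; there)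
open import Data.Nat as ℕ using (ℕ; zero; suc; _+_; _*_; _∸_; _^_; _<_; _≤_; z≤n; s≤s; NonZero)
import Data.Nat.Properties as ℕₚ
import Data.Nat.Coprimality as Coprimality
open import Data.Nat.Coprimality using (Coprime; coprime-divisor; coprime⇒gcd≡1)
import Data.Nat.Tactic.RingSolver as ℕTactic
import Data.Nat.DivMod as ℕDivMod
open import Data.Nat.Divisibility using (_∣_; _∤_; divides; ∣-trans; ∣1⇒≡1; 0∣⇒≡0; ∣⇒≤; m∣m*n; n∣m*n; _∣?_)
open import Data.Nat.Induction using (<-rec)
open import Data.Nat.LCM using (lcm; m∣lcm[m,n]; n∣lcm[m,n]; lcm-least; gcd*lcm)
open import Data.Nat.ListAction using (sum; product)
open import Data.Nat.Primality using (Prime; prime?; euclidsLemma; prime⇒irreducible; prime⇒nonTrivial)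
open import Data.Nat.Primality.Factorisation using (factorise)
open import Data.Product using (∃; ∃₂; _×_; _,_; proj₁; proj₂)
open import Data.Rational as ℚ using (ℚ; 0ℚ) renaming (_≤_ to _≤ℚ_)
import Data.Rational.Properties as ℚₚ
open import Data.Rational.Unnormalised as ℚᵘ using (mkℚᵘ)
import Data.Rational.Unnormalised.Properties as ℚᵘₚ
open import Data.Sum using (_⊎_; inj₁; inj₂; [_,_])
open import Function using (_∘_; case_of_)
open import Relation.Binary.PropositionalEquality using (_≡_; _≢_; refl; sym; trans; cong; cong₂; subst; subst₂; module ≡-Reasoning)
open import Relation.Nullary using (Dec; yes; no; does; ¬_; contradiction)
open import Relation.Nullary.Decidable using (_×-dec_; dec-true; dec-false)
open import Relation.Unary using (Pred; Decidable)

-- Finite sums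

module ℚ+ = CommSemigroupProperties (CommutativeMonoid.commutativeSemigroup ℚₚ.+-0-commutativeMonoid)
module ℕ+ = CommSemigroupProperties ℕₚ.+-commutativeSemigroup
module ℕ* = CommSemigroupProperties ℕₚ.*-commutativeSemigroup

∑ : {A : Set} → List A → (A → ℚ) → ℚ
∑ xs f = sumℚ (List.map f xs)

syntax ∑ xs (λ x → e) = ∑[ x ∈ xs ] e

module _ {A : Set} where

  ∑-cong : (xs : List A) {f g : A → ℚ} → (∀ x → f x ≡ g x) → ∑ xs f ≡ ∑ xs g
  ∑-cong []       f≗g = refl
  ∑-cong (x ∷ xs) f≗g = cong₂ ℚ._+_ (f≗g x) (∑-cong xs f≗g)

  ∑-mono-≤ : (xs : List A) {f g : A → ℚ} → (∀ x → f x ≤ℚ g x) → ∑ xs f ≤ℚ ∑ xs g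
  ∑-mono-≤ []       f≤g = ℚₚ.≤-refl
  ∑-mono-≤ (x ∷ xs) f≤g = ℚₚ.+-mono-≤ (f≤g x) (∑-mono-≤ xs f≤g)

  ∑-zero : (xs : List A) → ∑[ x ∈ xs ] 0ℚ ≡ 0ℚ
  ∑-zero []       = refl
  ∑-zero (x ∷ xs) = trans (ℚₚ.+-identityˡ _) (∑-zero xs)

  ∑-nonNeg : (xs : List A) {f : A → ℚ} → (∀ x → 0ℚ ≤ℚ f x) → 0ℚ ≤ℚ ∑ xs f
  ∑-nonNeg xs {f} 0≤f = subst (_≤ℚ ∑ xs f) (∑-zero xs) (∑-mono-≤ xs 0≤f)

  ∈⇒≤∑ : {xs : List A} {f : A → ℚ} {x : A} → x ∈ xs → (∀ y → 0ℚ ≤ℚ f y) → f x ≤ℚ ∑ xs f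
  ∈⇒≤∑ {y ∷ xs} {f} (here refl) 0≤f =
    subst (_≤ℚ ∑ (y ∷ xs) f) (ℚₚ.+-identityʳ (f y)) (ℚₚ.+-monoʳ-≤ (f y) (∑-nonNeg xs 0≤f))
  ∈⇒≤∑ {y ∷ xs} {f} (there x∈xs) 0≤f =
    subst (_≤ℚ ∑ (y ∷ xs) f) (ℚₚ.+-identityˡ _) (ℚₚ.+-mono-≤ (0≤f y) (∈⇒≤∑ x∈xs 0≤f))

  ∑-filter : {P : Pred A 0ℓ} (P? : Decidable P) (xs : List A) (f : A → ℚ) →
             ∑ (filter P? xs) f ≡ ∑[ x ∈ xs ] (if does (P? x) then f x else 0ℚ)
  ∑-filter P? []       f = refl
  ∑-filter P? (x ∷ xs) f with does (P? x)
  ... | true  = cong (f x ℚ.+_) (∑-filter P? xs f)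
  ... | false = trans (∑-filter P? xs f) (sym (ℚₚ.+-identityˡ _))

  ∑-distrib-+ : (xs : List A) (f g : A → ℚ) → ∑[ x ∈ xs ] (f x ℚ.+ g x) ≡ ∑ xs f ℚ.+ ∑ xs g
  ∑-distrib-+ []       f g = sym (ℚₚ.+-identityˡ 0ℚ)
  ∑-distrib-+ (x ∷ xs) f g =
    trans (cong (f x ℚ.+ g x ℚ.+_) (∑-distrib-+ xs f g)) (ℚ+.interchange (f x) (g x) _ _)

∑-comm : {A B : Set} (xs : List A) (ys : List B) (f : A → B → ℚ) →
         ∑[ x ∈ xs ] ∑[ y ∈ ys ] f x y ≡ ∑[ y ∈ ys ] ∑[ x ∈ xs ] f x y
∑-comm []       ys f = sym (∑-zero ys)
∑-comm (x ∷ xs) ys f =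
  trans (cong (∑ ys (f x) ℚ.+_) (∑-comm xs ys f)) (sym (∑-distrib-+ ys (f x) _))

∑< : ℕ → (ℕ → ℕ) → ℕ
∑< zero    f = 0
∑< (suc n) f = f 0 + ∑< n (f ∘ suc)

syntax ∑< n (λ v → e) = ∑[ v < n ] e

∑<-cong : ∀ n {f g : ℕ → ℕ} → (∀ v → f v ≡ g v) → ∑< n f ≡ ∑< n g
∑<-cong zero    f≗g = refl
∑<-cong (suc n) f≗g = cong₂ _+_ (f≗g 0) (∑<-cong n (f≗g ∘ suc))

∑<-mono-≤ : ∀ n {f g : ℕ → ℕ} → (∀ v → f v ≤ g v) → ∑< n f ≤ ∑< n g
∑<-mono-≤ zero    f≤g = z≤n
∑<-mono-≤ (suc n) f≤g = ℕₚ.+-mono-≤ (f≤g 0) (∑<-mono-≤ n (f≤g ∘ suc))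

∑<-const : ∀ n c → ∑[ _ < n ] c ≡ n * c
∑<-const zero    c = refl
∑<-const (suc n) c = cong (_+_ c) (∑<-const n c)

∑<-+ : ∀ m n f → ∑< (m + n) f ≡ ∑< m f + ∑[ v < n ] f (m + v)
∑<-+ zero    n f = refl
∑<-+ (suc m) n f = trans (cong (_+_ (f 0)) (∑<-+ m n (f ∘ suc))) (sym (ℕₚ.+-assoc (f 0) _ _))

∑<-* : ∀ K T f → ∑< (K * T) f ≡ ∑[ b < K ] ∑[ w < T ] f (b * T + w)
∑<-* zero    T f = refl
∑<-* (suc K) T f = trans (∑<-+ T (K * T) f) (cong (_+_ (∑< T f))
  (trans (∑<-* K T (λ v → f (T + v)))
         (∑<-cong K (λ b → ∑<-cong T (λ w → cong f (sym (ℕₚ.+-assoc T (b * T) w)))))))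

∑<-distrib-+ : ∀ n (f g : ℕ → ℕ) → ∑[ v < n ] (f v + g v) ≡ ∑< n f + ∑< n g
∑<-distrib-+ zero    f g = refl
∑<-distrib-+ (suc n) f g =
  trans (cong (_+_ (f 0 + g 0)) (∑<-distrib-+ n (f ∘ suc) (g ∘ suc))) (ℕ+.interchange (f 0) (g 0) _ _)

∑<-sum-comm : ∀ {A : Set} n (xs : List A) (f : ℕ → A → ℕ) →
              ∑[ v < n ] sum (List.map (f v) xs) ≡ sum (List.map (λ x → ∑[ v < n ] f v x) xs)
∑<-sum-comm n []       f = trans (∑<-const n 0) (ℕₚ.*-zeroʳ n)
∑<-sum-comm n (x ∷ xs) f =
  trans (∑<-distrib-+ n (λ v → f v x) _) (cong (_+_ (∑[ v < n ] f v x)) (∑<-sum-comm n xs f))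

≤∑< : ∀ {n w} (f : ℕ → ℕ) → w < n → f w ≤ ∑< n f
≤∑< {suc n} {zero}  f _         = ℕₚ.m≤m+n (f 0) _
≤∑< {suc n} {suc w} f (s≤s w<n) = ℕₚ.≤-trans (≤∑< (f ∘ suc) w<n) (ℕₚ.m≤n+m _ (f 0))

𝟙 : {A : Set} → Dec A → ℕ
𝟙 A? = if does A? then 1 else 0

#< : ℕ → {Φ : ℕ → Set} → (∀ v → Dec (Φ v)) → ℕ
#< n Φ? = ∑[ v < n ] 𝟙 (Φ? v)

private
  variable
    Φ : ℕ → Set

#<-witness : ∀ n (Φ? : ∀ v → Dec (Φ v)) → 1 ≤ #< n Φ? → ∃ Φ
#<-witness (suc n) Φ? pos with Φ? 0
... | yes Φ0 = 0 , Φ0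
... | no _   with #<-witness n (Φ? ∘ suc) pos
...   | v , Φv = suc v , Φv

#<-≥1 : ∀ {n w} (Φ? : ∀ v → Dec (Φ v)) → w < n → Φ w → 1 ≤ #< n Φ?
#<-≥1 {w = w} Φ? w<n Φw with Φ? w | ≤∑< (𝟙 ∘ Φ?) w<n
... | yes _  | 1≤# = 1≤#
... | no ¬Φw | _   = contradiction Φw ¬Φw

#<-none : ∀ n (Φ? : ∀ v → Dec (Φ v)) → (∀ {w} → w < n → ¬ Φ w) → #< n Φ? ≡ 0
#<-none zero    Φ? none = refl
#<-none (suc n) Φ? none with Φ? 0
... | yes Φ0 = contradiction Φ0 (none ℕ.z<s)
... | no _   = #<-none n (Φ? ∘ suc) (none ∘ s≤s)

#<-≤1 : ∀ n (Φ? : ∀ v → Dec (Φ v)) →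
        (∀ {w w′} → w < n → w′ < n → Φ w → Φ w′ → w ≡ w′) → #< n Φ? ≤ 1
#<-≤1 zero    Φ? unique = z≤n
#<-≤1 (suc n) Φ? unique with Φ? 0
... | no _   = #<-≤1 n (Φ? ∘ suc) λ w<n w′<n Φw Φw′ →
                 ℕₚ.suc-injective (unique (s≤s w<n) (s≤s w′<n) Φw Φw′)
... | yes Φ0 = s≤s (ℕₚ.≤-reflexive (#<-none n (Φ? ∘ suc) λ w<n Φw →
                 ℕₚ.0≢1+n (unique ℕ.z<s (s≤s w<n) Φ0 Φw)))

#<-blocks-≥ : ∀ K T (Φ? : ∀ v → Dec (Φ v)) →
              (∀ b → 1 ≤ #< T (λ w → Φ? (b * T + w))) → K ≤ #< (K * T) Φ?
#<-blocks-≥ K T Φ? hit = begin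
  K                                      ≡⟨ sym (ℕₚ.*-identityʳ K) ⟩
  K * 1                                  ≡⟨ sym (∑<-const K 1) ⟩
  ∑[ _ < K ] 1                           ≤⟨ ∑<-mono-≤ K hit ⟩
  ∑[ b < K ] #< T (λ w → Φ? (b * T + w)) ≡⟨ sym (∑<-* K T (𝟙 ∘ Φ?)) ⟩
  #< (K * T) Φ?                          ∎
  where open ℕₚ.≤-Reasoning

#<-blocks-≤ : ∀ K T (Φ? : ∀ v → Dec (Φ v)) →
              (∀ b → #< T (λ w → Φ? (b * T + w)) ≤ 1) → #< (K * T) Φ? ≤ K
#<-blocks-≤ K T Φ? sparse = begin
  #< (K * T) Φ?                          ≡⟨ ∑<-* K T (𝟙 ∘ Φ?) ⟩
  ∑[ b < K ] #< T (λ w → Φ? (b * T + w)) ≤⟨ ∑<-mono-≤ K sparse ⟩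
  ∑[ _ < K ] 1                           ≡⟨ ∑<-const K 1 ⟩
  K * 1                                  ≡⟨ ℕₚ.*-identityʳ K ⟩
  K                                      ∎
  where open ℕₚ.≤-Reasoning

count≡#< : ∀ Q {P : Fin Q → Set} (P? : ∀ y → Dec (P y)) {P′ : ℕ → Set} (P′? : ∀ v → Dec (P′ v)) →
           (∀ y → does (P? y) ≡ does (P′? (toℕ y))) → count Q P P? ≡ #< Q P′?
count≡#< Q P? P′? agree = begin
  count Q _ P?                          ≡⟨ length-filter P? (allFin Q) ⟩
  sum (List.map (𝟙 ∘ P?) (allFin Q))    ≡⟨ cong sum (Listₚ.map-tabulate (λ y → y) (𝟙 ∘ P?)) ⟩
  sum (List.tabulate (𝟙 ∘ P?))          ≡⟨ sum-tabulate Q (𝟙 ∘ P?) (λ y → cong (λ b → if b then 1 else 0) (agree y)) ⟩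
  #< Q P′?                              ∎
  where
  open ≡-Reasoning
  length-filter : ∀ {A : Set} {R : Pred A 0ℓ} (R? : Decidable R) xs →
                  length (filter R? xs) ≡ sum (List.map (𝟙 ∘ R?) xs)
  length-filter R? []       = refl
  length-filter R? (x ∷ xs) with does (R? x)
  ... | true  = cong suc (length-filter R? xs)
  ... | false = length-filter R? xs
  sum-tabulate : ∀ n (f : Fin n → ℕ) {g : ℕ → ℕ} → (∀ i → f i ≡ g (toℕ i)) →
                 sum (List.tabulate f) ≡ ∑< n g
  sum-tabulate zero    f f≗g = refl
  sum-tabulate (suc n) f f≗g = cong₂ _+_ (f≗g Fin.zero) (sum-tabulate n (f ∘ Fin.suc) (f≗g ∘ Fin.suc))

1≤∑𝟙 : ∀ {X : Set} {B : X → Set} (B? : ∀ x → Dec (B x)) {x xs} → x ∈ xs → B x →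
       1 ≤ sum (List.map (𝟙 ∘ B?) xs)
1≤∑𝟙 B? {x} (here refl) Bx with B? x
... | yes _  = s≤s z≤n
... | no ¬Bx = contradiction Bx ¬Bx
1≤∑𝟙 B? {xs = y ∷ _} (there x∈xs) Bx = ℕₚ.≤-trans (1≤∑𝟙 B? x∈xs Bx) (ℕₚ.m≤n+m _ (𝟙 (B? y)))

𝟙≤∑𝟙 : ∀ {A X : Set} {B : X → Set} (A? : Dec A) (B? : ∀ x → Dec (B x)) (xs : List X) →
       (A → ∃ λ x → x ∈ xs × B x) → 𝟙 A? ≤ sum (List.map (𝟙 ∘ B?) xs)
𝟙≤∑𝟙 (no _)  B? xs _    = z≤n
𝟙≤∑𝟙 (yes a) B? xs some = let x , x∈xs , Bx = some a in 1≤∑𝟙 B? x∈xs Bx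

-- Fractions

toℚᵘ-frac : ∀ a b → ℚ.toℚᵘ (frac a (suc b)) ℚᵘ.≃ mkℚᵘ (+ a) b
toℚᵘ-frac a b = ℚₚ.toℚᵘ-fromℚᵘ (mkℚᵘ (+ a) b)

frac-suc-≤ : ∀ a b c e → a * suc e ≤ c * suc b → frac a (suc b) ≤ℚ frac c (suc e)
frac-suc-≤ a b c e ae≤cb = ℚₚ.toℚᵘ-cancel-≤
  (ℚᵘₚ.≤-respʳ-≃ (ℚᵘₚ.≃-sym (toℚᵘ-frac c e)) (ℚᵘₚ.≤-respˡ-≃ (ℚᵘₚ.≃-sym (toℚᵘ-frac a b))
    (ℚᵘ.*≤* (subst₂ ℤ._≤_ (ℤₚ.pos-* a (suc e)) (ℤₚ.pos-* c (suc b)) (ℤ.+≤+ ae≤cb)))))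

frac-0 : ∀ b → frac 0 b ≡ 0ℚ
frac-0 zero    = refl
frac-0 (suc b) = ℚₚ.0/n≡0 (suc b)

frac-nonNeg : ∀ a b → 0ℚ ≤ℚ frac a b
frac-nonNeg a zero    = ℚₚ.≤-refl
frac-nonNeg a (suc b) = subst (_≤ℚ frac a (suc b)) (frac-0 (suc b)) (frac-suc-≤ 0 b a b z≤n)

frac-≤ : ∀ {a b c e} → .{{NonZero e}} → a * e ≤ c * b → frac a b ≤ℚ frac c e
frac-≤ {a} {zero}  {c} {e}     _     = frac-nonNeg c e
frac-≤ {a} {suc b} {c} {suc e} ae≤cb = frac-suc-≤ a b c e ae≤cb

frac-monoˡ-≤ : ∀ {a c} b → a ≤ c → frac a b ≤ℚ frac c b
frac-monoˡ-≤         zero    a≤c = ℚₚ.≤-refl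
frac-monoˡ-≤ {a} {c} (suc b) a≤c = frac-≤ {a} {suc b} {c} (ℕₚ.*-monoˡ-≤ (suc b) a≤c)

frac-+ : ∀ a c b → frac (a + c) b ≡ frac a b ℚ.+ frac c b
frac-+ a c zero    = sym (ℚₚ.+-identityˡ 0ℚ)
frac-+ a c (suc b) = ℚₚ.toℚᵘ-injective (ℚᵘₚ.≃-trans (toℚᵘ-frac (a + c) b)
  (ℚᵘₚ.≃-trans (ℚᵘ.*≡* cross) (ℚᵘₚ.≃-sym (ℚᵘₚ.≃-trans (ℚₚ.toℚᵘ-homo-+ (frac a (suc b)) (frac c (suc b)))
                                                        (ℚᵘₚ.+-cong (toℚᵘ-frac a b) (toℚᵘ-frac c b))))))
  where
  cross : + (a + c) ℤ.* (+ suc b ℤ.* + suc b) ≡ (+ a ℤ.* + suc b ℤ.+ + c ℤ.* + suc b) ℤ.* + suc b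
  cross = trans (cong (ℤ._* (+ suc b ℤ.* + suc b)) (ℤₚ.pos-+ a c)) (identity (+ a) (+ c) (+ suc b))
    where
    identity : ∀ x y z → (x ℤ.+ y) ℤ.* (z ℤ.* z) ≡ (x ℤ.* z ℤ.+ y ℤ.* z) ℤ.* z
    identity = ℤTactic.solve-∀

frac-sum : ∀ {A : Set} (xs : List A) (f : A → ℕ) b →
           frac (sum (List.map f xs)) b ≡ ∑[ x ∈ xs ] frac (f x) b
frac-sum []       f b = frac-0 b
frac-sum (x ∷ xs) f b = trans (frac-+ (f x) _ b) (cong (frac (f x) b ℚ.+_) (frac-sum xs f b))

≤-if : ∀ {A : Set} (A? : Dec A) {w u v : ℚ} → (A → w ≤ℚ u) → (¬ A → w ≤ℚ v) →
       w ≤ℚ (if does A? then u else v)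
≤-if (yes a) w≤u _   = w≤u a
≤-if (no ¬a) _   w≤v = w≤v ¬a

if-≤ : ∀ {A : Set} (A? : Dec A) {u v w : ℚ} → (A → u ≤ℚ w) → (¬ A → v ≤ℚ w) →
       (if does A? then u else v) ≤ℚ w
if-≤ (yes a) u≤w _   = u≤w a
if-≤ (no ¬a) _   v≤w = v≤w ¬a

-- Divisibility and primes

coprime⇒*∣ : ∀ {m n k} → Coprime m n → m ∣ k → n ∣ k → m * n ∣ k
coprime⇒*∣ {m} {n} m⊥n m∣k n∣k = subst (_∣ _) lcm≡m*n (lcm-least m∣k n∣k)
  where
  lcm≡m*n : lcm m n ≡ m * n
  lcm≡m*n = trans (sym (ℕₚ.*-identityˡ (lcm m n)))
                  (trans (cong (_* lcm m n) (sym (coprime⇒gcd≡1 m⊥n))) (gcd*lcm m n))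

prime⇒1< : ∀ {p} → Prime p → 1 < p
prime⇒1< {p} pp = ℕ.nonTrivial⇒n>1 p {{prime⇒nonTrivial pp}}

prime∤1 : ∀ {p} → Prime p → p ∤ 1
prime∤1 pp p∣1 = ℕₚ.>⇒≢ (prime⇒1< pp) (∣1⇒≡1 p∣1)

prime∣^⇒≡ : ∀ {q p} → Prime q → Prime p → ∀ e → q ∣ p ^ e → q ≡ p
prime∣^⇒≡ qp pp zero    q∣1       = contradiction q∣1 (prime∤1 qp)
prime∣^⇒≡ qp pp (suc e) q∣p*p^e with euclidsLemma _ _ qp q∣p*p^e
... | inj₂ q∣p^e = prime∣^⇒≡ qp pp e q∣p^e
... | inj₁ q∣p   with prime⇒irreducible pp q∣p
...   | inj₁ q≡1 = contradiction q≡1 (ℕₚ.>⇒≢ (prime⇒1< qp))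
...   | inj₂ q≡p = q≡p

prime∣∏⇒∣ : ∀ {A : Set} {q} → Prime q → (f : A → ℕ) (xs : List A) →
            q ∣ product (List.map f xs) → ∃ λ x → q ∣ f x
prime∣∏⇒∣ qp f []       q∣1 = contradiction q∣1 (prime∤1 qp)
prime∣∏⇒∣ qp f (x ∷ xs) q∣∏ with euclidsLemma (f x) _ qp q∣∏
... | inj₁ q∣fx = x , q∣fx
... | inj₂ q∣∏′ = prime∣∏⇒∣ qp f xs q∣∏′

no-common-prime⇒coprime : ∀ {m n} → .{{NonZero m}} → (∀ {q} → Prime q → q ∣ m → q ∤ n) → Coprime m n
no-common-prime⇒coprime {m} {n} disjoint {zero} (0∣m , _) = contradiction (0∣⇒≡0 0∣m) (ℕ.≢-nonZero⁻¹ m)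
no-common-prime⇒coprime {m} {n} disjoint {i@(suc _)} (i∣m , i∣n) with factorise i
... | record { factors = [] ; isFactorisation = i≡1 } = i≡1
... | record { factors = q ∷ _ ; isFactorisation = i≡q*_ ; factorsPrime = qp ∷ _ } =
  contradiction (∣-trans q∣i i∣n) (disjoint qp (∣-trans q∣i i∣m))
  where
  q∣i : q ∣ i
  q∣i = subst (q ∣_) (sym i≡q*_) (m∣m*n _)

split-off-prime : ∀ {p} → Prime p → ∀ m → m ≢ 0 → ∃₂ λ r g → m ≡ g * p ^ r × p ∤ g
split-off-prime {p} pp = <-rec _ go
  where
  go : ∀ m → (∀ {m′} → m′ < m → m′ ≢ 0 → ∃₂ λ r g → m′ ≡ g * p ^ r × p ∤ g) →
       m ≢ 0 → ∃₂ λ r g → m ≡ g * p ^ r × p ∤ g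
  go m rec m≢0 with p ∣? m
  ... | no p∤m = 0 , m , sym (ℕₚ.*-identityʳ m) , p∤m
  ... | yes (divides m′ refl) with rec m′<m′*p m′≢0
    where
    m′≢0 : m′ ≢ 0
    m′≢0 refl = m≢0 refl
    m′<m′*p : m′ < m′ * p
    m′<m′*p = ℕₚ.m<m*n m′ p {{ℕ.≢-nonZero m′≢0}} (prime⇒1< pp)
  ...   | r , g , refl , p∤g = suc r , g , ℕ*.xy∙z≈x∙zy g (p ^ r) p , p∤g

if-∧-elim : ∀ {A B : Set} (A? : Dec A) (B? : Dec B) {x y : ℕ} (P : ℕ → Set) →
            (A → B → P x) → (¬ (A × B) → P y) → P (if does A? ∧ does B? then x else y)
if-∧-elim (yes a)  (yes b)  P both _       = both a b
if-∧-elim (yes _)  (no ¬b)  P _    neither = neither (¬b ∘ proj₂)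
if-∧-elim (no ¬a)  _        P _    neither = neither (¬a ∘ proj₁)

lpfAux-∣ : ∀ m k → lpfAux m k ≡ 1 ⊎ lpfAux m k ∣ m
lpfAux-∣ m zero    = inj₁ refl
lpfAux-∣ m (suc k) = if-∧-elim (prime? (suc k)) (suc k ∣? m) (λ t → t ≡ 1 ⊎ t ∣ m)
  (λ _ k+1∣m → inj₂ k+1∣m) (λ _ → lpfAux-∣ m k)

≤lpfAux : ∀ m k {q} → Prime q → q ∣ m → q ≤ k → q ≤ lpfAux m k
≤lpfAux m zero    qp _   q≤0   = contradiction (ℕₚ.<-≤-trans (prime⇒1< qp) q≤0) λ ()
≤lpfAux m (suc k) {q} qp q∣m q≤1+k = if-∧-elim (prime? (suc k)) (suc k ∣? m) (q ≤_)
  (λ _ _ → q≤1+k) (λ ¬both → ≤lpfAux m k qp q∣m (ℕₚ.≤-pred (ℕₚ.≤∧≢⇒< q≤1+k λ { refl → ¬both (qp , q∣m) })))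

P⁺-∣ : ∀ {m p} → Prime p → P⁺ m ≡ p → p ∣ m
P⁺-∣ {m} pp P⁺≡p with lpfAux-∣ m m
... | inj₁ P⁺≡1 = contradiction (trans (sym P⁺≡p) P⁺≡1) (ℕₚ.>⇒≢ (prime⇒1< pp))
... | inj₂ P⁺∣m = subst (_∣ m) P⁺≡p P⁺∣m

prime∣⇒≤P⁺ : ∀ {m q} → .{{NonZero m}} → Prime q → q ∣ m → q ≤ P⁺ m
prime∣⇒≤P⁺ {m} qp q∣m = ≤lpfAux m m qp q∣m (∣⇒≤ q∣m)

∣lcmAll : ∀ n (d : Fin n → ℕ) i → d i ∣ lcmAll n d
∣lcmAll (suc n) d Fin.zero    = m∣lcm[m,n] (d Fin.zero) _
∣lcmAll (suc n) d (Fin.suc i) = ∣-trans (∣lcmAll n (d ∘ Fin.suc) i) (n∣lcm[m,n] (d Fin.zero) _)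

-- Residues

infix 4 _≡_mod_ _≡?_mod_

_≡_mod_ : ℕ → ℤ → ℕ → Set
v ≡ a mod m = (+ m) ℤ∣.∣ (+ v ℤ.- a)

_≡?_mod_ : ∀ v a m → Dec (v ≡ a mod m)
v ≡? a mod m = (+ m) ℤ∣.∣? (+ v ℤ.- a)

∣∧<⇒≡0 : ∀ {T m} → T ∣ m → m < T → m ≡ 0
∣∧<⇒≡0 {m = zero}  _   _   = refl
∣∧<⇒≡0 {m = suc _} T∣m m<T = contradiction (∣⇒≤ T∣m) (ℕₚ.<⇒≱ m<T)

∣⊖∣∧<⇒≡ : ∀ {T w w′} → w ≤ w′ → w′ < T → T ∣ ℤ.∣ w ℤ.⊖ w′ ∣ → w ≡ w′
∣⊖∣∧<⇒≡ {T} {w} {w′} w≤w′ w′<T T∣ = ℕₚ.≤-antisym w≤w′ (ℕₚ.m∸n≡0⇒m≤n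
  (∣∧<⇒≡0 (subst (T ∣_) (ℤₚ.∣⊖∣-≤ w≤w′) T∣) (ℕₚ.≤-<-trans (ℕₚ.m∸n≤m w′ w) w′<T)))

∣-∣∧<⇒≡ : ∀ {T w w′} → w < T → w′ < T → T ∣ ℤ.∣ + w ℤ.- + w′ ∣ → w ≡ w′
∣-∣∧<⇒≡ {T} {w} {w′} w<T w′<T T∣ with ℕₚ.≤-total w w′ | subst (T ∣_) (cong ℤ.∣_∣ (ℤₚ.m-n≡m⊖n w w′)) T∣
... | inj₁ w≤w′ | T∣⊖ = ∣⊖∣∧<⇒≡ w≤w′ w′<T T∣⊖
... | inj₂ w′≤w | T∣⊖ = sym (∣⊖∣∧<⇒≡ w′≤w w<T (subst (T ∣_) (ℤₚ.∣m⊖n∣≡∣n⊖m∣ w w′) T∣⊖))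

module _ (M : ℕ) .{{_ : NonZero M}} (x : ℕ) where

  #≡mod-≥ : ∀ {Q K} → Q ≡ K * M → K ≤ #< Q (λ v → v ≡? + x mod M)
  #≡mod-≥ {K = K} refl = #<-blocks-≥ K M (λ v → v ≡? + x mod M)
    (λ b → #<-≥1 (λ w → (b * M + w) ≡? + x mod M) (ℕDivMod.m%n<n x M) (residue b))
    where
    residue : ∀ b → (b * M + x ℕ.% M) ≡ + x mod M
    residue b = subst (λ t → (b * M + x ℕ.% M) ≡ + t mod M) (sym (ℕDivMod.m≡m%n+[m/n]*n x M))
                      (shifted b (x ℕ.% M) (x ℕ./ M))
      where
      cast : ∀ c r → + (c * M + r) ≡ + c ℤ.* + M ℤ.+ + r
      cast c r = trans (ℤₚ.pos-+ (c * M) r) (cong (ℤ._+ + r) (ℤₚ.pos-* c M))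
      identity : ∀ b q m r → (b ℤ.* m ℤ.+ r) ℤ.- (q ℤ.* m ℤ.+ r) ≡ (b ℤ.- q) ℤ.* m
      identity = ℤTactic.solve-∀
      shifted : ∀ b r q → (b * M + r) ≡ + (r + q * M) mod M
      shifted b r q = ℤ∣.divides (+ b ℤ.- + q) (begin
        + (b * M + r) ℤ.- + (r + q * M)                  ≡⟨ cong₂ ℤ._-_ (cast b r) (trans (cong (λ t → + t) (ℕₚ.+-comm r _)) (cast q r)) ⟩
        (+ b ℤ.* + M ℤ.+ + r) ℤ.- (+ q ℤ.* + M ℤ.+ + r)  ≡⟨ identity (+ b) (+ q) (+ M) (+ r) ⟩
        (+ b ℤ.- + q) ℤ.* + M                            ∎)
        where open ≡-Reasoning

  #≡mod∩≡mod-≤ : ∀ {Q E s d} (a : ℤ) → Coprime M s → s ∣ d → Q ≡ E * (M * s) →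
                 #< Q (λ v → (v ≡? + x mod M) ×-dec (v ≡? a mod d)) ≤ E
  #≡mod∩≡mod-≤ {E = E} {s} {d} a M⊥s s∣d refl =
    #<-blocks-≤ E (M * s) common (λ b → #<-≤1 (M * s) (λ w → common (b * (M * s) + w)) (unique b))
    where
    common : ∀ v → Dec (v ≡ + x mod M × v ≡ a mod d)
    common v = (v ≡? + x mod M) ×-dec (v ≡? a mod d)
    shift : ∀ c w w′ y → (+ (c + w) ℤ.- y) ℤ.- (+ (c + w′) ℤ.- y) ≡ + w ℤ.- + w′
    shift c w w′ y = trans (cong₂ (λ s t → (s ℤ.- y) ℤ.- (t ℤ.- y)) (ℤₚ.pos-+ c w) (ℤₚ.pos-+ c w′))
      (identity (+ c) (+ w) (+ w′) y)
      where
      identity : ∀ c w w′ y → ((c ℤ.+ w) ℤ.- y) ℤ.- ((c ℤ.+ w′) ℤ.- y) ≡ w ℤ.- w′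
      identity = ℤTactic.solve-∀
    ∣difference : ∀ c y {m w w′} → (c + w) ≡ y mod m → (c + w′) ≡ y mod m → m ∣ ℤ.∣ + w ℤ.- + w′ ∣
    ∣difference c y {m} {w} {w′} cw≡y cw′≡y =
      ℤ∣.∣⇒∣ᵤ (subst ((+ m) ℤ∣.∣_) (shift c w w′ y) (ℤ∣.∣m∣n⇒∣m-n cw≡y cw′≡y))
    unique : ∀ b {w w′} → w < M * s → w′ < M * s →
             (b * (M * s) + w) ≡ + x mod M × (b * (M * s) + w) ≡ a mod d →
             (b * (M * s) + w′) ≡ + x mod M × (b * (M * s) + w′) ≡ a mod d → w ≡ w′
    unique b w<T w′<T (w≡x , w≡a) (w′≡x , w′≡a) = ∣-∣∧<⇒≡ w<T w′<T
      (coprime⇒*∣ M⊥s (∣difference (b * (M * s)) (+ x) w≡x w′≡x) (∣-trans s∣d (∣difference (b * (M * s)) a w≡a w′≡a)))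

common-residue⇒ClassSubset : ∀ {Q M d g v} {x : Fin Q} {a : ℤ} → M ∣ Q → g ∣ M → g ∣ d →
                             v ≡ + toℕ x mod M → v ≡ a mod d → ClassSubset Q x a g
common-residue⇒ClassSubset {Q} {M} {d} {g} {v} {x} {a} M∣Q g∣M g∣d v≡x v≡a z Q∣z-x =
  subst ((+ g) ℤ∣.∣_) (sym (split z (+ toℕ x) (+ v) a))
    (ℤ∣.∣m∣n⇒∣m+n (ℤ∣.∣m∣n⇒∣m-n (ℤ∣.∣-trans (ℤ∣.∣ᵤ⇒∣ (∣-trans g∣M M∣Q)) Q∣z-x)
                                (ℤ∣.∣-trans (ℤ∣.∣ᵤ⇒∣ g∣M) v≡x))
                  (ℤ∣.∣-trans (ℤ∣.∣ᵤ⇒∣ g∣d) v≡a))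
  where
  split : ∀ z x v a → z ℤ.- a ≡ ((z ℤ.- x) ℤ.- (v ℤ.- x)) ℤ.+ (v ℤ.- a)
  split = ℤTactic.solve-∀

-- Products of prime powers

∏-distrib-* : ∀ {A : Set} (xs : List A) (f g : A → ℕ) →
              product (List.map (λ x → f x * g x) xs) ≡ product (List.map f xs) * product (List.map g xs)
∏-distrib-* []       f g = refl
∏-distrib-* (x ∷ xs) f g =
  trans (cong (_*_ (f x * g x)) (∏-distrib-* xs f g)) (ℕ*.interchange (f x) (g x) _ _)

∏-single : ∀ {J} (f : Fin J → ℕ) j → (∀ i → i ≢ j → f i ≡ 1) → product (List.map f (allFin J)) ≡ f j
∏-single f j others = trans (cong product (Listₚ.map-tabulate (λ i → i) f)) (go f j others)
  where
  ∏-ones : ∀ {J} (f : Fin J → ℕ) → (∀ i → f i ≡ 1) → product (List.tabulate f) ≡ 1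
  ∏-ones {zero}  f ones = refl
  ∏-ones {suc J} f ones = cong₂ _*_ (ones Fin.zero) (∏-ones (f ∘ Fin.suc) (ones ∘ Fin.suc))
  go : ∀ {J} (f : Fin J → ℕ) j → (∀ i → i ≢ j → f i ≡ 1) → product (List.tabulate f) ≡ f j
  go f Fin.zero    others = trans (cong (_*_ (f Fin.zero)) (∏-ones (f ∘ Fin.suc) (λ i → others (Fin.suc i) λ ())))
                                  (ℕₚ.*-identityʳ _)
  go f (Fin.suc j) others = trans (cong (_* product (List.tabulate (f ∘ Fin.suc))) (others Fin.zero λ ()))
    (trans (ℕₚ.*-identityˡ _) (go (f ∘ Fin.suc) j (λ i i≢j → others (Fin.suc i) (i≢j ∘ Finₚ.suc-injective))))

factor-trichotomy : ∀ {m k} (m<?k : Dec (m < k)) (m≟k : Dec (m ≡ k)) (k<?m : Dec (k < m)) e →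
  e ≡ (if does m<?k then e else 1) * ((if does m≟k then e else 1) * (if does k<?m then e else 1))
factor-trichotomy (yes _)   (no _)     (no _)    e = sym (ℕₚ.*-identityʳ e)
factor-trichotomy (no _)    (yes _)    (no _)    e = sym (trans (ℕₚ.+-identityʳ (e * 1)) (ℕₚ.*-identityʳ e))
factor-trichotomy (no _)    (no _)     (yes _)   e = sym (trans (ℕₚ.+-identityʳ (1 * e)) (ℕₚ.*-identityˡ e))
factor-trichotomy (no m≮k)  (no m≢k)   (no k≮m)  e = ⊥-elim (m≢k (ℕₚ.≤-antisym (ℕₚ.≮⇒≥ k≮m) (ℕₚ.≮⇒≥ m≮k)))
factor-trichotomy (yes m<k) (yes refl) _         e = ⊥-elim (ℕₚ.<-irrefl refl m<k)
factor-trichotomy (yes m<k) (no _)     (yes k<m) e = ⊥-elim (ℕₚ.<-asym m<k k<m)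
factor-trichotomy (no _)    (yes refl) (yes k<m) e = ⊥-elim (ℕₚ.<-irrefl refl k<m)

module PrimePowerProduct (J : ℕ) (p ν : Fin J → ℕ) (p-prime : ∀ i → Prime (p i))
                         (p-increasing : ∀ i i′ → i Fin.< i′ → p i < p i′) where

  ∏[_] : {S : Fin J → Set} → (∀ i → Dec (S i)) → ℕ
  ∏[ S? ] = product (List.map (λ i → if does (S? i) then p i ^ ν i else 1) (allFin J))

  prime∣∏⇒ : {S : Fin J → Set} (S? : ∀ i → Dec (S i)) {q : ℕ} → Prime q → q ∣ ∏[ S? ] → ∃ λ i → S i × q ≡ p i
  prime∣∏⇒ S? qp q∣∏ with prime∣∏⇒∣ qp _ (allFin J) q∣∏
  ... | i , q∣factor with S? i
  ...   | yes Si = i , Si , prime∣^⇒≡ qp (p-prime i) (ν i) q∣factor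
  ...   | no _   = contradiction q∣factor (prime∤1 qp)

  above : Fin J → ℕ
  above j = ∏[ (λ i → toℕ j ℕ.<? toℕ i) ]

  Qpre-split : ∀ j → Qpre J p ν J ≡ Qpre J p ν (toℕ j) * (p j ^ ν j * above j)
  Qpre-split j = begin
    Qpre J p ν J                                   ≡⟨ cong product (Listₚ.map-cong all-factors (allFin J)) ⟩
    ∏ (λ i → below i * (at i * beyond i))          ≡⟨ ∏-distrib-* (allFin J) below _ ⟩
    Qpre J p ν (toℕ j) * ∏ (λ i → at i * beyond i) ≡⟨ cong (_*_ (Qpre J p ν (toℕ j))) (∏-distrib-* (allFin J) at beyond) ⟩
    Qpre J p ν (toℕ j) * (∏ at * above j)          ≡⟨ cong (λ t → Qpre J p ν (toℕ j) * (t * above j)) ∏at≡p^ν ⟩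
    Qpre J p ν (toℕ j) * (p j ^ ν j * above j)     ∎
    where
    open ≡-Reasoning
    ∏ : (Fin J → ℕ) → ℕ
    ∏ f = product (List.map f (allFin J))
    below at beyond : Fin J → ℕ
    below  i = if does (toℕ i ℕ.<? toℕ j) then p i ^ ν i else 1
    at     i = if does (toℕ i ℕ.≟ toℕ j) then p i ^ ν i else 1
    beyond i = if does (toℕ j ℕ.<? toℕ i) then p i ^ ν i else 1
    all-factors : ∀ i → (if does (toℕ i ℕ.<? J) then p i ^ ν i else 1) ≡ below i * (at i * beyond i)
    all-factors i = trans (cong (λ b → if b then p i ^ ν i else 1) (dec-true (toℕ i ℕ.<? J) (Finₚ.toℕ<n i)))
      (factor-trichotomy (toℕ i ℕ.<? toℕ j) (toℕ i ℕ.≟ toℕ j) (toℕ j ℕ.<? toℕ i) (p i ^ ν i))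
    ∏at≡p^ν : ∏ at ≡ p j ^ ν j
    ∏at≡p^ν = trans (∏-single at j off-j) (cong (λ b → if b then p j ^ ν j else 1) (dec-true (toℕ j ℕ.≟ toℕ j) refl))
      where
      off-j : ∀ i → i ≢ j → at i ≡ 1
      off-j i i≢j = cong (λ b → if b then p i ^ ν i else 1) (dec-false (toℕ i ℕ.≟ toℕ j) (i≢j ∘ Finₚ.toℕ-injective))

  p∤Qpre : ∀ j → p j ∤ Qpre J p ν (toℕ j)
  p∤Qpre j p∣Q with prime∣∏⇒ (λ i → toℕ i ℕ.<? toℕ j) (p-prime j) p∣Q
  ... | i , i<j , pj≡pi = ℕₚ.<⇒≢ (p-increasing i j i<j) (sym pj≡pi)

  prime∣above⇒> : ∀ j {q} → Prime q → q ∣ above j → p j < q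
  prime∣above⇒> j qp q∣R with prime∣∏⇒ (λ i → toℕ j ℕ.<? toℕ i) qp q∣R
  ... | i , j<i , refl = p-increasing j i j<i

  p∤above : ∀ j → p j ∤ above j
  p∤above j p∣R = ℕₚ.<-irrefl refl (prime∣above⇒> j (p-prime j) p∣R)

∈-map-suc-upTo : ∀ {k m} → 1 ≤ k → k ≤ m → k ∈ List.map suc (upTo m)
∈-map-suc-upTo {suc k} (s≤s _) k<m = ∈-map⁺ suc (∈-upTo⁺ k<m)

module AlphaBound (n : ℕ) (a : Fin n → ℤ) (d : Fin n → ℕ) (d>1 : ∀ i → 1 < d i)
                  (J : ℕ) (p ν : Fin J → ℕ) (p-prime : ∀ j → Prime (p j))
                  (p-increasing : ∀ j j′ → j Fin.< j′ → p j < p j′)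
                  (Q≡ : lcmAll n d ≡ Qpre J p ν J) (x : Fin (lcmAll n d)) (j : Fin J) where

  open PrimePowerProduct J p ν p-prime p-increasing

  Q M P V R : ℕ
  Q = lcmAll n d
  M = Qpre J p ν (toℕ j)
  P = p j
  V = ν j
  R = above j

  Q≡M*P^V*R : Q ≡ M * (P ^ V * R)
  Q≡M*P^V*R = trans Q≡ (Qpre-split j)

  instance
    Q≢0 : NonZero Q
    Q≢0 = ℕ.>-nonZero (ℕₚ.≤-<-trans z≤n (Finₚ.toℕ<n x))

    M≢0 : NonZero M
    M≢0 = ℕ.≢-nonZero λ M≡0 → ℕ.≢-nonZero⁻¹ Q (trans Q≡M*P^V*R (cong (_* (P ^ V * R)) M≡0))

    P≢0 : NonZero P
    P≢0 = ℕ.>-nonZero (ℕₚ.<-trans ℕ.z<s (prime⇒1< (p-prime j)))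

    d≢0 : ∀ {i} → NonZero (d i)
    d≢0 {i} = ℕ.>-nonZero (ℕₚ.<-trans ℕ.z<s (d>1 i))

  M∣Q : M ∣ Q
  M∣Q = subst (M ∣_) (sym Q≡M*P^V*R) (m∣m*n _)

  P^r⊥ : ∀ r {m} → P ∤ m → Coprime (P ^ r) m
  P^r⊥ r P∤m = no-common-prime⇒coprime {{ℕₚ.m^n≢0 P r}} λ qp q∣P^r q∣m →
    P∤m (subst (_∣ _) (prime∣^⇒≡ qp (p-prime j) r q∣P^r) q∣m)

  P^r∣Q⇒r≤V : ∀ {r} → P ^ r ∣ Q → r ≤ V
  P^r∣Q⇒r≤V {r} P^r∣Q =
    ℕₚ.≮⇒≥ λ V<r → ℕₚ.<⇒≱ (ℕₚ.^-monoʳ-< P (prime⇒1< (p-prime j)) V<r) (∣⇒≤ {{ℕₚ.m^n≢0 P V}} P^r∣P^V)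
    where
    P∤M*R : P ∤ M * R
    P∤M*R P∣M*R = [ p∤Qpre j , p∤above j ] (euclidsLemma M R (p-prime j) P∣M*R)
    P^r∣P^V : P ^ r ∣ P ^ V
    P^r∣P^V = coprime-divisor (P^r⊥ r P∤M*R)
      (subst (P ^ r ∣_) (trans Q≡M*P^V*R (ℕ*.x∙yz≈xz∙y M (P ^ V) R)) P^r∣Q)

  ∣Q∧primes≤P⇒∣M : ∀ {g} → .{{NonZero g}} → g ∣ Q → P ∤ g → (∀ {q} → Prime q → q ∣ g → q ≤ P) → g ∣ M
  ∣Q∧primes≤P⇒∣M {g} g∣Q P∤g primes≤P =
    coprime-divisor g⊥P^V*R (subst (g ∣_) (trans Q≡M*P^V*R (ℕₚ.*-comm M _)) g∣Q)
    where
    g⊥P^V*R : Coprime g (P ^ V * R)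
    g⊥P^V*R = no-common-prime⇒coprime λ {q} qp q∣g q∣P^V*R → case euclidsLemma (P ^ V) R qp q∣P^V*R of λ
      { (inj₁ q∣P^V) → P∤g (subst (_∣ g) (prime∣^⇒≡ qp (p-prime j) V q∣P^V) q∣g)
      ; (inj₂ q∣R)   → ℕₚ.<⇒≱ (prime∣above⇒> j qp q∣R) (primes≤P qp q∣g) }

  record Split (i : Fin n) : Set where
    field
      r g    : ℕ
      d≡gP^r : d i ≡ g * P ^ r
      1≤r    : 1 ≤ r
      r≤V    : r ≤ V
      g∣M    : g ∣ M

    g∣d : g ∣ d i
    g∣d = subst (g ∣_) (sym d≡gP^r) (m∣m*n _)

    P^r∣d : P ^ r ∣ d i
    P^r∣d = subst (P ^ r ∣_) (sym d≡gP^r) (n∣m*n g)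

    1≤g : 1 ≤ g
    1≤g = ℕₚ.n≢0⇒n>0 λ g≡0 → ℕ.≢-nonZero⁻¹ M (0∣⇒≡0 (subst (_∣ M) g≡0 g∣M))

  split : ∀ i → P⁺ (d i) ≡ P → Split i
  split i P⁺≡P with split-off-prime (p-prime j) (d i) (ℕ.≢-nonZero⁻¹ (d i))
  ... | r , g , d≡gP^r , P∤g = record
    { r = r ; g = g ; d≡gP^r = d≡gP^r
    ; 1≤r = ℕₚ.n≢0⇒n>0 λ { refl → P∤g (subst (P ∣_) (trans d≡gP^r (ℕₚ.*-identityʳ g)) (P⁺-∣ (p-prime j) P⁺≡P)) }
    ; r≤V = P^r∣Q⇒r≤V (∣-trans (subst (P ^ r ∣_) (sym d≡gP^r) (n∣m*n g)) (∣lcmAll n d i))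
    ; g∣M = ∣Q∧primes≤P⇒∣M {{g≢0}} (∣-trans g∣d (∣lcmAll n d i)) P∤g
              (λ qp q∣g → subst (_ ≤_) P⁺≡P (prime∣⇒≤P⁺ qp (∣-trans q∣g g∣d)))
    }
    where
    g∣d : g ∣ d i
    g∣d = subst (g ∣_) (sym d≡gP^r) (m∣m*n _)
    g≢0 : NonZero g
    g≢0 = ℕ.≢-nonZero λ { refl → ℕ.≢-nonZero⁻¹ (d i) d≡gP^r }

  F? : ∀ v → Dec (v ≡ + toℕ x mod M)
  F? v = v ≡? + toℕ x mod M

  N : ℕ
  N = #< Q F?

  hits : Fin n → ℕ
  hits i = #< Q (λ v → F? v ×-dec (v ≡? a i mod d i))

  module _ {i : Fin n} (s : Split i) where
    open Split s

    hits*P^r≤N : hits i * P ^ r ≤ N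
    hits*P^r≤N = begin
      hits i * P ^ r ≤⟨ ℕₚ.*-monoˡ-≤ (P ^ r) (#≡mod∩≡mod-≤ M (toℕ x) {E = E} (a i) M⊥P^r P^r∣d Q≡E*[M*P^r]) ⟩
      E * P ^ r      ≡⟨ ℕₚ.*-comm E (P ^ r) ⟩
      P ^ r * E      ≤⟨ #≡mod-≥ M (toℕ x) Q≡[P^r*E]*M ⟩
      N              ∎
      where
      open ℕₚ.≤-Reasoning
      E : ℕ
      E = P ^ (V ∸ r) * R
      M⊥P^r : Coprime M (P ^ r)
      M⊥P^r = Coprimality.sym (P^r⊥ r (p∤Qpre j))
      Q≡M*[P^r*P^[V∸r]*R] : Q ≡ M * (P ^ r * P ^ (V ∸ r) * R)
      Q≡M*[P^r*P^[V∸r]*R] = trans Q≡M*P^V*R (cong (λ t → M * (t * R))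
        (trans (cong (P ^_) (sym (ℕₚ.m+[n∸m]≡n r≤V))) (ℕₚ.^-distribˡ-+-* P r (V ∸ r))))
      Q≡E*[M*P^r] : Q ≡ E * (M * P ^ r)
      Q≡E*[M*P^r] = trans Q≡M*[P^r*P^[V∸r]*R] (rearrange M (P ^ r) (P ^ (V ∸ r)) R)
        where
        rearrange : ∀ m a b c → m * (a * b * c) ≡ b * c * (m * a)
        rearrange = ℕTactic.solve-∀
      Q≡[P^r*E]*M : Q ≡ (P ^ r * E) * M
      Q≡[P^r*E]*M = trans Q≡M*[P^r*P^[V∸r]*R] (rearrange M (P ^ r) (P ^ (V ∸ r)) R)
        where
        rearrange : ∀ m a b c → m * (a * b * c) ≡ a * (b * c) * m
        rearrange = ℕTactic.solve-∀

    hits≢0⇒ClassSubset : 1 ≤ hits i → ClassSubset Q x (a i) g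
    hits≢0⇒ClassSubset 1≤hits with #<-witness Q (λ v → F? v ×-dec (v ≡? a i mod d i)) 1≤hits
    ... | v , v≡x , v≡a = common-residue⇒ClassSubset M∣Q g∣M g∣d v≡x v≡a

  hits/N≤ : ∀ {i} (s : Split i) → let open Split s in
            frac (hits i) N ≤ℚ (if does (classSubset? Q x (a i) g) then frac 1 (P ^ r) else 0ℚ)
  hits/N≤ {i} s = ≤-if (classSubset? Q x (a i) g)
    (λ _ → frac-≤ {{ℕₚ.m^n≢0 P r}} (ℕₚ.≤-trans (hits*P^r≤N s) (ℕₚ.≤-reflexive (sym (ℕₚ.*-identityˡ N)))))
    (λ ¬sub → ℚₚ.≤-reflexive (trans (cong (λ t → frac t N) (hits≡0 ¬sub)) (frac-0 N)))
    where
    open Split s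
    hits≡0 : ¬ ClassSubset Q x (a i) g → hits i ≡ 0
    hits≡0 ¬sub = ℕₚ.n<1⇒n≡0 (ℕₚ.≰⇒> (¬sub ∘ hits≢0⇒ClassSubset s))

  B? : ∀ v → Dec (∃ λ i → P⁺ (d i) ≡ P × (v ≡ a i mod d i))
  B? v = any? (λ i → (P⁺ (d i) ℕ.≟ P) ×-dec (v ≡? a i mod d i))

  Is : List (Fin n)
  Is = filter (λ i → P⁺ (d i) ℕ.≟ P) (allFin n)

  α≡ : α n a d J p ν j x ≡ frac (#< Q (λ v → F? v ×-dec B? v)) N
  α≡ = cong₂ frac (count≡#< Q _ (λ v → F? v ×-dec B? v) (λ _ → refl)) (count≡#< Q _ F? (λ _ → refl))

  union-bound : #< Q (λ v → F? v ×-dec B? v) ≤ sum (List.map hits Is)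
  union-bound = ℕₚ.≤-trans (∑<-mono-≤ Q pointwise) (ℕₚ.≤-reflexive (∑<-sum-comm Q Is _))
    where
    pointwise : ∀ v → 𝟙 (F? v ×-dec B? v) ≤ sum (List.map (λ i → 𝟙 (F? v ×-dec (v ≡? a i mod d i))) Is)
    pointwise v = 𝟙≤∑𝟙 (F? v ×-dec B? v) (λ i → F? v ×-dec (v ≡? a i mod d i)) Is
      λ (v≡x , i , P⁺≡P , v≡a) → i , ∈-filter⁺ (λ i → P⁺ (d i) ℕ.≟ P) (∈-allFin i) P⁺≡P , v≡x , v≡a

  Rs Gs : List ℕ
  Rs = List.map suc (upTo V)
  Gs = filter (_∣? M) (List.map suc (upTo M))

  term : ℕ → ℕ → Fin n → ℚ
  term r g i = if does (d i ℕ.≟ g * P ^ r)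
               then (if does (classSubset? Q x (a i) g) then frac 1 (P ^ r) else 0ℚ) else 0ℚ

  0≤term : ∀ r g i → 0ℚ ≤ℚ term r g i
  0≤term r g i = ≤-if (d i ℕ.≟ g * P ^ r)
    (λ _ → ≤-if (classSubset? Q x (a i) g) (λ _ → frac-nonNeg 1 (P ^ r)) (λ _ → ℚₚ.≤-refl)) (λ _ → ℚₚ.≤-refl)

  0≤∑term : ∀ r i → 0ℚ ≤ℚ ∑[ g ∈ Gs ] term r g i
  0≤∑term r i = ∑-nonNeg Gs (λ g → 0≤term r g i)

  bound≡ : bound n a d J p ν j x ≡ ∑[ i ∈ allFin n ] ∑[ r ∈ Rs ] ∑[ g ∈ Gs ] term r g i
  bound≡ = begin
    bound n a d J p ν j x
      ≡⟨ ∑-cong Rs (λ r → ∑-cong Gs (λ g → ∑-filter (λ i → d i ℕ.≟ g * P ^ r) (allFin n) _)) ⟩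
    ∑[ r ∈ Rs ] ∑[ g ∈ Gs ] ∑[ i ∈ allFin n ] term r g i
      ≡⟨ ∑-cong Rs (λ r → ∑-comm Gs (allFin n) (λ g i → term r g i)) ⟩
    ∑[ r ∈ Rs ] ∑[ i ∈ allFin n ] ∑[ g ∈ Gs ] term r g i
      ≡⟨ ∑-comm Rs (allFin n) (λ r i → ∑[ g ∈ Gs ] term r g i) ⟩
    ∑[ i ∈ allFin n ] ∑[ r ∈ Rs ] ∑[ g ∈ Gs ] term r g i ∎
    where open ≡-Reasoning

  hits/N≤∑term : ∀ i → (if does (P⁺ (d i) ℕ.≟ P) then frac (hits i) N else 0ℚ) ≤ℚ ∑[ r ∈ Rs ] ∑[ g ∈ Gs ] term r g i
  hits/N≤∑term i = if-≤ (P⁺ (d i) ℕ.≟ P) on-Is (λ _ → ∑-nonNeg Rs (λ r → 0≤∑term r i))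
    where
    on-Is : P⁺ (d i) ≡ P → frac (hits i) N ≤ℚ ∑[ r ∈ Rs ] ∑[ g ∈ Gs ] term r g i
    on-Is P⁺≡P = begin
      frac (hits i) N                  ≤⟨ ≤-if (d i ℕ.≟ g * P ^ r) (λ _ → hits/N≤ s) (λ d≢ → contradiction d≡gP^r d≢) ⟩
      term r g i                       ≤⟨ ∈⇒≤∑ g∈Gs (λ g → 0≤term r g i) ⟩
      ∑[ g ∈ Gs ] term r g i           ≤⟨ ∈⇒≤∑ r∈Rs (λ r → 0≤∑term r i) ⟩
      ∑[ r ∈ Rs ] ∑[ g ∈ Gs ] term r g i ∎
      where
      open ℚₚ.≤-Reasoning
      s = split i P⁺≡P
      open Split s
      r∈Rs : r ∈ Rs
      r∈Rs = ∈-map-suc-upTo 1≤r r≤V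
      g∈Gs : g ∈ Gs
      g∈Gs = ∈-filter⁺ (_∣? M) (∈-map-suc-upTo 1≤g (∣⇒≤ g∣M)) g∣M

  α≤bound : α n a d J p ν j x ≤ℚ bound n a d J p ν j x
  α≤bound = begin
    α n a d J p ν j x                                     ≡⟨ α≡ ⟩
    frac (#< Q (λ v → F? v ×-dec B? v)) N                 ≤⟨ frac-monoˡ-≤ N union-bound ⟩
    frac (sum (List.map hits Is)) N                       ≡⟨ frac-sum Is hits N ⟩
    ∑[ i ∈ Is ] frac (hits i) N                           ≡⟨ ∑-filter (λ i → P⁺ (d i) ℕ.≟ P) (allFin n) _ ⟩
    ∑[ i ∈ allFin n ] (if does (P⁺ (d i) ℕ.≟ P) then frac (hits i) N else 0ℚ)
                                                          ≤⟨ ∑-mono-≤ (allFin n) hits/N≤∑term ⟩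
    ∑[ i ∈ allFin n ] ∑[ r ∈ Rs ] ∑[ g ∈ Gs ] term r g i  ≡⟨ sym bound≡ ⟩
    bound n a d J p ν j x                                 ∎
    where open ℚₚ.≤-Reasoning

lemma2 : (n : ℕ) (a : Fin n → ℤ) (d : Fin n → ℕ)
    → (∀ i → 1 < d i)
    → (∀ (i i′ : Fin n) → i Fin.≤ i′ → d i ≤ d i′)
    → (J : ℕ) (p : Fin J → ℕ) (ν : Fin J → ℕ)
    → (∀ j → Prime (p j))
    → (∀ (j j′ : Fin J) → j Fin.< j′ → p j < p j′)
    → (∀ j → 1 ≤ ν j)
    → lcmAll n d ≡ Qpre J p ν J
    → (x : Fin (lcmAll n d)) (j : Fin J)
    → α n a d J p ν j x ≤ℚ bound n a d J p ν j x
lemma2 n a d d>1 _ J p ν p-prime p-increasing _ Q≡ x j =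
  AlphaBound.α≤bound n a d d>1 J p ν p-prime p-increasing Q≡ x j
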